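{- Let $\mathbb{F}_{729}$ be the field with $729$ elements and let $G_{729,28}=\{x\in\mathbb{F}_{729}: x^{28}=1\}$ be the unique subgroup of order $28$ of $\mathbb{F}_{729}^\times$. For $a,b,c\in G_{729,28}$, we have $a+b+c=0$ if and only if $a=b=c$. -}

module Defs where

open import Data.Nat using (ℕ; zero; suc)

data 𝔽₃ : Set where
  f0 f1 f2 : 𝔽₃

infixl 6 _+₃_
infixl 7 _*₃_

_+₃_ : 𝔽₃ → 𝔽₃ → 𝔽₃
f0 +₃ y  = y
f1 +₃ f0 = f1
f1 +₃ f1 = f2
f1 +₃ f2 = f0
f2 +₃ f0 = f2
f2 +₃ f1 = f0
f2 +₃ f2 = f1

_*₃_ : 𝔽₃ → 𝔽₃ → 𝔽₃
f0 *₃ y  = f0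
f1 *₃ y  = y
f2 *₃ f0 = f0
f2 *₃ f1 = f2
f2 *₃ f2 = f1

-- The field 𝔽₇₂₉ = 𝔽₃[X] / (X⁶ + X + 2).
-- X⁶ + X + 2 is irreducible over 𝔽₃ (it has no monic factor of degree
-- 1, 2 or 3), so this quotient is the field with 3⁶ = 729 elements.
-- An element  c₀ + c₁ X + … + c₅ X⁵  is stored as  el c₀ c₁ c₂ c₃ c₄ c₅.

record 𝔽₇₂₉ : Set where
  constructor el
  field
    c₀ c₁ c₂ c₃ c₄ c₅ : 𝔽₃

infixl 6 _+_
infixl 7 _*_ _·_
infixr 8 _^_

0# : 𝔽₇₂₉
0# = el f0 f0 f0 f0 f0 f0

1# : 𝔽₇₂₉
1# = el f1 f0 f0 f0 f0 f0

_+_ : 𝔽₇₂₉ → 𝔽₇₂₉ → 𝔽₇₂₉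
el a₀ a₁ a₂ a₃ a₄ a₅ + el b₀ b₁ b₂ b₃ b₄ b₅ =
  el (a₀ +₃ b₀) (a₁ +₃ b₁) (a₂ +₃ b₂) (a₃ +₃ b₃) (a₄ +₃ b₄) (a₅ +₃ b₅)

_·_ : 𝔽₃ → 𝔽₇₂₉ → 𝔽₇₂₉
s · el b₀ b₁ b₂ b₃ b₄ b₅ =
  el (s *₃ b₀) (s *₃ b₁) (s *₃ b₂) (s *₃ b₃) (s *₃ b₄) (s *₃ b₅)

-- multiplication by X, using X⁶ = -X - 2 = 2X + 1
mulX : 𝔽₇₂₉ → 𝔽₇₂₉
mulX (el a₀ a₁ a₂ a₃ a₄ a₅) = el a₅ (a₀ +₃ f2 *₃ a₅) a₁ a₂ a₃ a₄

_*_ : 𝔽₇₂₉ → 𝔽₇₂₉ → 𝔽₇₂₉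
el a₀ a₁ a₂ a₃ a₄ a₅ * b =
  let r₅ = a₅ · b
      r₄ = mulX r₅ + a₄ · b
      r₃ = mulX r₄ + a₃ · b
      r₂ = mulX r₃ + a₂ · b
      r₁ = mulX r₂ + a₁ · b
  in  mulX r₁ + a₀ · b

_^_ : 𝔽₇₂₉ → ℕ → 𝔽₇₂₉
x ^ zero  = 1#
x ^ suc n = x * (x ^ n)

G₂₈ : 𝔽₇₂₉ → Set
G₂₈ x = x ^ 28 ≡ 1#
  where open import Relation.Binary.PropositionalEquality using (_≡_)

-- In characteristic 3 we have a + b + c = 0 exactly when c = −(a + b), and
-- a + a + a = 0 always; so the theorem amounts to: if a, b and −(a + b) all
-- lie in G₂₈ then a = b. Since X⁶ + X + 2 is a primitive polynomial, X
-- generates 𝔽₇₂₉^×, so G₂₈ is the cyclic group generated by X²⁶ = X^(728/28),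
-- and the remaining statement is a check over its 28² pairs of elements.
module Submission where

open import Defs
open import Data.List using (List; iterate)
open import Data.List.Membership.Propositional using (_∈_)
open import Data.List.Relation.Unary.All as All using (All; all?)
open import Data.Product using (_×_; _,_)
open import Function.Bundles using (_⇔_; mk⇔)
open import Relation.Binary.Definitions using (DecidableEquality)
open import Relation.Binary.PropositionalEquality
  using (_≡_; refl; sym; cong; subst; module ≡-Reasoning)
open import Relation.Nullary.Decidable
  using (Dec; yes; no; map′; from-yes; _×-dec_; _→-dec_)
open import Relation.Unary using (Decidable)

infix 4 _≟₃_ _≟_

_≟₃_ : DecidableEquality 𝔽₃
f0 ≟₃ f0 = yes refl
f1 ≟₃ f1 = yes refl
f2 ≟₃ f2 = yes refl
f0 ≟₃ f1 = no λ ()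
f0 ≟₃ f2 = no λ ()
f1 ≟₃ f0 = no λ ()
f1 ≟₃ f2 = no λ ()
f2 ≟₃ f0 = no λ ()
f2 ≟₃ f1 = no λ ()

_≟_ : DecidableEquality 𝔽₇₂₉
el a₀ a₁ a₂ a₃ a₄ a₅ ≟ el b₀ b₁ b₂ b₃ b₄ b₅ =
  map′ (λ { (refl , refl , refl , refl , refl , refl) → refl })
       (λ { refl → refl , refl , refl , refl , refl , refl })
       (a₀ ≟₃ b₀ ×-dec a₁ ≟₃ b₁ ×-dec a₂ ≟₃ b₂ ×-dec
        a₃ ≟₃ b₃ ×-dec a₄ ≟₃ b₄ ×-dec a₅ ≟₃ b₅)

open import Data.List.Membership.DecPropositional _≟_ using (_∈?_)

∀₃? : {P : 𝔽₃ → Set} → Decidable P → Dec (∀ x → P x)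
∀₃? P? = map′ (λ { (p₀ , p₁ , p₂) → λ { f0 → p₀ ; f1 → p₁ ; f2 → p₂ } })
              (λ p → p f0 , p f1 , p f2)
              (P? f0 ×-dec P? f1 ×-dec P? f2)

∀? : {P : 𝔽₇₂₉ → Set} → Decidable P → Dec (∀ x → P x)
∀? P? = map′ (λ p → λ { (el a₀ a₁ a₂ a₃ a₄ a₅) → p a₀ a₁ a₂ a₃ a₄ a₅ })
             (λ p a₀ a₁ a₂ a₃ a₄ a₅ → p (el a₀ a₁ a₂ a₃ a₄ a₅))
             (∀₃? λ a₀ → ∀₃? λ a₁ → ∀₃? λ a₂ → ∀₃? λ a₃ → ∀₃? λ a₄ → ∀₃? λ a₅ →
              P? (el a₀ a₁ a₂ a₃ a₄ a₅))

-_ : 𝔽₇₂₉ → 𝔽₇₂₉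
- x = f2 · x

x+y+z≡0⇒z≡-[x+y]₃ : ∀ x y z → x +₃ y +₃ z ≡ f0 → z ≡ f2 *₃ (x +₃ y)
x+y+z≡0⇒z≡-[x+y]₃ = from-yes
  (∀₃? λ x → ∀₃? λ y → ∀₃? λ z → x +₃ y +₃ z ≟₃ f0 →-dec z ≟₃ f2 *₃ (x +₃ y))

x+x+x≡0₃ : ∀ x → x +₃ x +₃ x ≡ f0
x+x+x≡0₃ = from-yes (∀₃? λ x → x +₃ x +₃ x ≟₃ f0)

x+y+z≡0⇒z≡-[x+y] : ∀ x y z → x + y + z ≡ 0# → z ≡ - (x + y)
x+y+z≡0⇒z≡-[x+y] (el x₀ x₁ x₂ x₃ x₄ x₅) (el y₀ y₁ y₂ y₃ y₄ y₅) (el z₀ z₁ z₂ z₃ z₄ z₅) sum≡0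
  rewrite x+y+z≡0⇒z≡-[x+y]₃ x₀ y₀ z₀ (cong 𝔽₇₂₉.c₀ sum≡0)
        | x+y+z≡0⇒z≡-[x+y]₃ x₁ y₁ z₁ (cong 𝔽₇₂₉.c₁ sum≡0)
        | x+y+z≡0⇒z≡-[x+y]₃ x₂ y₂ z₂ (cong 𝔽₇₂₉.c₂ sum≡0)
        | x+y+z≡0⇒z≡-[x+y]₃ x₃ y₃ z₃ (cong 𝔽₇₂₉.c₃ sum≡0)
        | x+y+z≡0⇒z≡-[x+y]₃ x₄ y₄ z₄ (cong 𝔽₇₂₉.c₄ sum≡0)
        | x+y+z≡0⇒z≡-[x+y]₃ x₅ y₅ z₅ (cong 𝔽₇₂₉.c₅ sum≡0) = refl

x+x+x≡0 : ∀ x → x + x + x ≡ 0#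
x+x+x≡0 (el x₀ x₁ x₂ x₃ x₄ x₅)
  rewrite x+x+x≡0₃ x₀ | x+x+x≡0₃ x₁ | x+x+x≡0₃ x₂
        | x+x+x≡0₃ x₃ | x+x+x≡0₃ x₄ | x+x+x≡0₃ x₅ = refl

-[x+x]≡x : ∀ x → - (x + x) ≡ x
-[x+x]≡x x = sym (x+y+z≡0⇒z≡-[x+y] x x x (x+x+x≡0 x))

X : 𝔽₇₂₉
X = el f0 f1 f0 f0 f0 f0

G₂₈-elements : List 𝔽₇₂₉
G₂₈-elements = iterate (X ^ 26 *_) 1# 28

G₂₈⇒∈ : ∀ x → G₂₈ x → x ∈ G₂₈-elements
G₂₈⇒∈ = from-yes (∀? λ x → x ^ 28 ≟ 1# →-dec x ∈? G₂₈-elements)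

-[a+b]∈G₂₈⇒a≡b :
  All (λ a → All (λ b → - (a + b) ∈ G₂₈-elements → a ≡ b) G₂₈-elements) G₂₈-elements
-[a+b]∈G₂₈⇒a≡b = from-yes
  (all? (λ a → all? (λ b → - (a + b) ∈? G₂₈-elements →-dec a ≟ b) G₂₈-elements) G₂₈-elements)

theorem1 : (a b c : 𝔽₇₂₉) → G₂₈ a → G₂₈ b → G₂₈ c →
    ((a + b + c ≡ 0#) ⇔ (a ≡ b × b ≡ c))
theorem1 a b c Ga Gb Gc = mk⇔ to from
  where
  to : a + b + c ≡ 0# → a ≡ b × b ≡ c
  to sum≡0 = a≡b , b≡c
    where
    c≡-[a+b] : c ≡ - (a + b)
    c≡-[a+b] = x+y+z≡0⇒z≡-[x+y] a b c sum≡0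
    a≡b : a ≡ b
    a≡b = All.lookup (All.lookup -[a+b]∈G₂₈⇒a≡b (G₂₈⇒∈ a Ga)) (G₂₈⇒∈ b Gb)
            (subst (_∈ G₂₈-elements) c≡-[a+b] (G₂₈⇒∈ c Gc))
    b≡c : b ≡ c
    b≡c = begin
      b           ≡⟨ sym (-[x+x]≡x b) ⟩
      - (b + b)   ≡⟨ cong (λ x → - (x + b)) (sym a≡b) ⟩
      - (a + b)   ≡⟨ sym c≡-[a+b] ⟩
      c           ∎
      where open ≡-Reasoning
  from : a ≡ b × b ≡ c → a + b + c ≡ 0#
  from (refl , refl) = x+x+x≡0 a
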